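{- If $x$ is a positive integer, then the only possible common prime divisor of $x^2-x+1$ and $x^6+3x^5+5x^4+6x^3+7x^2+6x+3$ is $31$. -}

module Defs where

open import Data.Nat using (ℕ; _+_; _*_; _∸_; _^_)

-- x² - x + 1 ; exact over ℕ since x² ≥ x for every natural x
f : ℕ → ℕ
f x = (x ^ 2 ∸ x) + 1

g : ℕ → ℕ
g x = x ^ 6 + 3 * x ^ 5 + 5 * x ^ 4 + 6 * x ^ 3 + 7 * x ^ 2 + 6 * x + 3

-- Let x = k + 1 be a positive integer and write F = k² + k + 1, which is
-- x² - x + 1 = f x in a form free of truncated subtraction.  The proof
-- rests on a polynomial Bézout-type identity: with the quartic
--   Q(x) = x⁴ + 4x³ + 8x² + 10x + 9
-- one has, as polynomials in x,
--   (5x + 1) · g(x) + 31 = ((5x + 1) · Q(x) + 25) · (x² - x + 1),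
-- verified below by the ring solver in the variable k.  Consequently any
-- common divisor of f x and g x divides 31, and a prime dividing the prime
-- 31 is 31 itself.

module Submission where

open import Defs
open import Data.Nat using (ℕ; _<_; suc; _+_; _*_; _∸_; _^_)
open import Data.Nat.Properties using (m+n∸n≡m)
open import Data.Nat.Divisibility using (_∣_; ∣n⇒∣m*n; ∣m+n∣m⇒∣n)
open import Data.Nat.Primality using (Prime; prime?; prime⇒irreducible; ¬prime[1])
open import Data.Nat.Solver using (module +-*-Solver)
open +-*-Solver using (solve; _:+_; _:*_; _:^_; _:=_; con)
open import Data.Sum using (inj₁; inj₂)
open import Relation.Nullary using (contradiction)
open import Relation.Nullary.Decidable using (from-yes)
open import Relation.Binary.PropositionalEquality using (_≡_; refl; subst; sym; cong; module ≡-Reasoning)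

-- If d divides m and n, then d divides every c satisfying u·n + c = v·m:
-- the divisibility form of "an integer combination of m and n".
∣-of-combination : ∀ {d m n} u v c → d ∣ m → d ∣ n → u * n + c ≡ v * m → d ∣ c
∣-of-combination {d} u v c d∣m d∣n un+c≡vm =
  ∣m+n∣m⇒∣n (subst (d ∣_) (sym un+c≡vm) (∣n⇒∣m*n v d∣m)) (∣n⇒∣m*n u d∣n)

prime∣prime⇒≡ : ∀ {p q} → Prime p → Prime q → p ∣ q → p ≡ q
prime∣prime⇒≡ pp pq p∣q with prime⇒irreducible pq p∣q
... | inj₁ p≡1 = contradiction (subst Prime p≡1 pp) ¬prime[1]
... | inj₂ p≡q = p≡q

square-suc : ∀ n → (1 + n) ^ 2 ≡ (n * n + n) + (1 + n)
square-suc = solve 1 (λ n → (con 1 :+ n) :^ 2 := (n :* n :+ n) :+ (con 1 :+ n)) refl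

f-suc : ∀ k → f (suc k) ≡ k * k + k + 1
f-suc k = cong (_+ 1) (begin
    suc k ^ 2 ∸ suc k             ≡⟨ cong (_∸ suc k) (square-suc k) ⟩
    (k * k + k) + suc k ∸ suc k   ≡⟨ m+n∸n≡m (k * k + k) (suc k) ⟩
    k * k + k                     ∎)
  where open ≡-Reasoning

Q : ℕ → ℕ
Q k = (1 + k) ^ 4 + 4 * (1 + k) ^ 3 + 8 * (1 + k) ^ 2 + 10 * (1 + k) + 9

bezout : ∀ k → (5 * k + 6) * g (suc k) + 31 ≡ ((5 * k + 6) * Q k + 25) * (k * k + k + 1)
bezout = solve 1 (λ k → let x = con 1 :+ k in
    (con 5 :* k :+ con 6)
      :* (x :^ 6 :+ con 3 :* x :^ 5 :+ con 5 :* x :^ 4 :+ con 6 :* x :^ 3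
          :+ con 7 :* x :^ 2 :+ con 6 :* x :+ con 3)
      :+ con 31
  := ((con 5 :* k :+ con 6)
        :* (x :^ 4 :+ con 4 :* x :^ 3 :+ con 8 :* x :^ 2 :+ con 10 :* x :+ con 9)
        :+ con 25)
      :* (k :* k :+ k :+ con 1)) refl

31-prime : Prime 31
31-prime = from-yes (prime? 31)

lemma4 : (x p : ℕ) → 0 < x → Prime p → p ∣ f x → p ∣ g x → p ≡ 31
lemma4 (suc k) p _ p-prime p∣f p∣g = prime∣prime⇒≡ p-prime 31-prime p∣31
  where
  p∣F : p ∣ k * k + k + 1
  p∣F = subst (p ∣_) (f-suc k) p∣f

  p∣31 : p ∣ 31
  p∣31 = ∣-of-combination (5 * k + 6) ((5 * k + 6) * Q k + 25) 31 p∣F p∣g (bezout k)
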